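{- Let $G$ be a connected outerplanar graph, let $\overrightarrow{G'}$ be a BFS-digraph of $G$, and fix a straight-line drawing of $\overrightarrow{G'}$ in which (1) each vertex at depth $i$ lies on the line $y=-i$, (2) any two edges are disjoint except possibly at common endpoints, and (3) for every vertex $v$ the vertical downward ray from $v$ meets the drawing only at $v$. Then every vertex has at most two parents. Moreover, if a vertex $v$ has two parents, then the two parents are consecutive, and $v$ is the rightmost child of its left parent and the leftmost child of its right parent.
   Context: Given a connected graph $G=(V,E)$ and a root vertex $r$, let $V_i$ be the set of vertices at distance exactly $i$ from $r$. The BFS-digraph $\overrightarrow{G'}$ has vertex set $V$ and an arc $\overrightarrow{(u,v)}$ for every edge $uv\in E$ with $u\in V_i$, $v\in V_{i+1}$ for some $i$; the depth of a vertex is the $i$ with $v\in V_i$. If $\overrightarrow{(u,v)}$ is an arc, $u$ is a parent of $v$ and $v$ is a child of $u$. In the drawing, two vertices are consecutive if they lie on the same horizontal line and no vertex lies between them; left/right and leftmost/rightmost refer to $x$-coordinates in the drawing.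
   Formalization: The straight-line drawing of $\overrightarrow{G'}$ has rational coordinates, so every vertex lies at a point with rational x-coordinate. -}

module Defs where

open import Data.Nat as ℕ using (ℕ; zero; suc)
open import Data.Fin using (Fin)
open import Data.Integer using (+_)
open import Data.Rational as ℚ using (ℚ; 0ℚ; 1ℚ; _/_)
open import Data.Product using (Σ; ∃; ∃-syntax; _×_; _,_)
open import Data.Sum using (_⊎_)
open import Relation.Nullary using (¬_)
open import Relation.Binary.PropositionalEquality using (_≡_; _≢_)

record Graph (n : ℕ) : Set₁ where
  field
    Adj     : Fin n → Fin n → Set
    symm    : ∀ {u v} → Adj u v → Adj v u
    irrefl  : ∀ {u} → ¬ Adj u u
open Graph public

data Walk {n : ℕ} (G : Graph n) : Fin n → Fin n → ℕ → Set where
  here : ∀ {u} → Walk G u u 0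
  step : ∀ {u w v k} → Adj G u w → Walk G w v k → Walk G u v (suc k)

Connected : ∀ {n} → Graph n → Set
Connected {n} G = ∀ (u v : Fin n) → ∃[ k ] Walk G u v k

IsDistFrom : ∀ {n} → Graph n → Fin n → (Fin n → ℕ) → Set
IsDistFrom {n} G r d =
  ∀ (v : Fin n) → Walk G r v (d v) × (∀ k → Walk G r v k → d v ℕ.≤ k)

-- Outerplanarity: the vertices can be placed in convex position (on a
-- circle, in the order given by an injective position map) so that no
-- two edges with four distinct endpoints cross as chords.

StrictlyBetween : ℕ → ℕ → ℕ → Set
StrictlyBetween a c b = (a ℕ.< c × c ℕ.< b) ⊎ (b ℕ.< c × c ℕ.< a)

-- chords ab and cd (four distinct endpoints) cross iff exactly one of
-- c, d lies strictly between a and b in the linear order of positions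
ChordsCross : ℕ → ℕ → ℕ → ℕ → Set
ChordsCross a b c d =
    (StrictlyBetween a c b × ¬ StrictlyBetween a d b)
  ⊎ (¬ StrictlyBetween a c b × StrictlyBetween a d b)

Outerplanar : ∀ {n} → Graph n → Set
Outerplanar {n} G =
  Σ (Fin n → ℕ) λ pos →
      (∀ u v → pos u ≡ pos v → u ≡ v)
    × (∀ a b c d → Adj G a b → Adj G c d →
         a ≢ c → a ≢ d → b ≢ c → b ≢ d →
         ¬ ChordsCross (pos a) (pos b) (pos c) (pos d))

Arc : ∀ {n} → Graph n → (Fin n → ℕ) → Fin n → Fin n → Set
Arc G d u v = Adj G u v × suc (d u) ≡ d v

Parent : ∀ {n} → Graph n → (Fin n → ℕ) → Fin n → Fin n → Set
Parent = Arc

Point : Set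
Point = ℚ × ℚ

ℕtoℚ : ℕ → ℚ
ℕtoℚ k = + k / 1

pt : ∀ {n} → (Fin n → ℚ) → (Fin n → ℕ) → Fin n → Point
pt x d v = (x v , ℚ.- ℕtoℚ (d v))

OnSegment : Point → Point → Point → Set
OnSegment (px , py) (ax , ay) (bx , by) =
  ∃[ t ] (0ℚ ℚ.≤ t × t ℚ.≤ 1ℚ
          × px ≡ (1ℚ ℚ.- t) ℚ.* ax ℚ.+ t ℚ.* bx
          × py ≡ (1ℚ ℚ.- t) ℚ.* ay ℚ.+ t ℚ.* by)

OnDrawing : ∀ {n} → Graph n → (Fin n → ℕ) → (Fin n → ℚ) → Point → Set
OnDrawing {n} G d x P =
    (∃[ w ] P ≡ pt x d w)
  ⊎ (∃[ u ] ∃[ v ] (Arc G d u v × OnSegment P (pt x d u) (pt x d v)))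

-- A straight-line drawing of the BFS-digraph satisfying (1)-(3).
-- (1) is built into pt.
record GoodDrawing {n} (G : Graph n) (d : Fin n → ℕ) (x : Fin n → ℚ) : Set where
  field
    injective : ∀ u v → pt x d u ≡ pt x d v → u ≡ v
    edgesDisjoint :
      ∀ u₁ v₁ u₂ v₂ → Arc G d u₁ v₁ → Arc G d u₂ v₂ →
      ¬ (u₁ ≡ u₂ × v₁ ≡ v₂) →
      ∀ P → OnSegment P (pt x d u₁) (pt x d v₁) → OnSegment P (pt x d u₂) (pt x d v₂) →
      ∃[ w ] ((w ≡ u₁ ⊎ w ≡ v₁) × (w ≡ u₂ ⊎ w ≡ v₂) × P ≡ pt x d w)
    rayFree :
      ∀ v (y : ℚ) → y ℚ.< ℚ.- ℕtoℚ (d v) → ¬ OnDrawing G d x (x v , y)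

Consecutive : ∀ {n} → (Fin n → ℕ) → (Fin n → ℚ) → Fin n → Fin n → Set
Consecutive {n} d x p q =
  d p ≡ d q × (∀ (w : Fin n) → d w ≡ d p → ¬ (x p ℚ.< x w × x w ℚ.< x q))

RightmostChild : ∀ {n} → Graph n → (Fin n → ℕ) → (Fin n → ℚ) → Fin n → Fin n → Set
RightmostChild {n} G d x v p =
  Parent G d p v × (∀ (c : Fin n) → Parent G d p c → x c ℚ.≤ x v)

LeftmostChild : ∀ {n} → Graph n → (Fin n → ℕ) → (Fin n → ℚ) → Fin n → Fin n → Set
LeftmostChild {n} G d x v p =
  Parent G d p v × (∀ (c : Fin n) → Parent G d p c → x v ℚ.≤ x c)

-- If p and q are parents of v with p left of q, a vertex w on their line strictly
-- between them would sit right above the arc pv or the arc qv, so its downward ray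
-- would hit the drawing. A child c of p to the right of v (or of q to the left of v)
-- would force the arcs pc and qv (resp. pv and qc) to cross between the two lines.
-- With three parents, the middle one would lie strictly between the outer two.
module Submission where

open import Defs
open import Data.Nat as ℕ using (ℕ; suc)
import Data.Nat.Properties as ℕ
open import Data.Nat.Coprimality using (1-coprimeTo) renaming (sym to coprime-sym)
import Data.Integer as ℤ
import Data.Integer.Properties as ℤ
open import Data.Rational using (ℚ; 0ℚ; 1ℚ; _<_; _≤_; _+_; _*_; -_; _-_; _÷_; 1/_; *<*; positive; Positive; NonZero)
open import Data.Rational.Properties
open import Data.Rational.Solver using (module +-*-Solver)
open import Data.Fin as Fin using (Fin)
open import Data.Product using (∃-syntax; proj₁; proj₂; _×_; _,_)
open import Data.Sum using (_⊎_; inj₁; inj₂; [_,_]′)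
open import Data.Empty using (⊥-elim)
open import Relation.Nullary using (¬_; yes; no)
open import Relation.Binary using (tri<; tri≈; tri>)
open import Function using (_∘_)
open import Relation.Binary.PropositionalEquality

open +-*-Solver using (solve; _:=_; _:+_; _:-_; _:*_; :-_; con)

ℕtoℚ-mono-< : ∀ {m n} → m ℕ.< n → ℕtoℚ m < ℕtoℚ n
ℕtoℚ-mono-< {m} {n} m<n
  rewrite normalize-coprime (coprime-sym (1-coprimeTo m))
        | normalize-coprime (coprime-sym (1-coprimeTo n))
  = *<* (subst₂ ℤ._<_ (sym (ℤ.*-identityʳ (ℤ.+ m))) (sym (ℤ.*-identityʳ (ℤ.+ n))) (ℤ.+<+ m<n))

0<q-p : ∀ {p q} → p < q → 0ℚ < q - p
0<q-p {p} {q} p<q = subst (_< q - p) (+-inverseʳ p) (+-monoˡ-< (- p) p<q)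

*-pos : ∀ {p q} → 0ℚ < p → 0ℚ < q → 0ℚ < p * q
*-pos {p} {q} 0<p 0<q = positive⁻¹ (p * q) {{pos*pos⇒pos p {{positive 0<p}} q {{positive 0<q}}}}

ratio-in-unit-interval : ∀ {p q} → 0ℚ < p → p ≤ q → ∃[ t ] (0ℚ < t × t ≤ 1ℚ × t * q ≡ p)
ratio-in-unit-interval {p} {q} 0<p p≤q = t , 0<t , t≤1 , t*q≡p
  where
  instance
    q-pos : Positive q
    q-pos = positive (<-≤-trans 0<p p≤q)
    q≢0 : NonZero q
    q≢0 = pos⇒nonZero q
    1/q-pos : Positive (1/ q)
    1/q-pos = 1/pos⇒pos q
  t : ℚ
  t = p ÷ q
  0<t : 0ℚ < t
  0<t = *-pos 0<p (positive⁻¹ (1/ q))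
  t≤1 : t ≤ 1ℚ
  t≤1 = subst (t ≤_) (*-inverseʳ q) (*-monoʳ-≤-nonNeg (1/ q) {{pos⇒nonNeg (1/ q)}} p≤q)
  t*q≡p : t * q ≡ p
  t*q≡p = trans (*-assoc p _ q) (trans (cong (p *_) (*-inverseˡ q)) (*-identityʳ p))

interpolate : ∀ {a w b} → a < w → w ≤ b → ∃[ t ] (0ℚ < t × t ≤ 1ℚ × (1ℚ - t) * a + t * b ≡ w)
interpolate {a} {w} {b} a<w w≤b =
  let t , 0<t , t≤1 , t[b-a]≡w-a = ratio-in-unit-interval (0<q-p a<w) (+-monoˡ-≤ (- a) w≤b)
  in t , 0<t , t≤1 , (begin
    (1ℚ - t) * a + t * b  ≡⟨ solve 3 (λ t a b → (con 1ℚ :- t) :* a :+ t :* b := a :+ t :* (b :- a)) refl t a b ⟩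
    a + t * (b - a)       ≡⟨ cong (a +_) t[b-a]≡w-a ⟩
    a + (w - a)           ≡⟨ solve 2 (λ a w → a :+ (w :- a) := w) refl a w ⟩
    w                     ∎)
  where open ≡-Reasoning

interpolate-reversed : ∀ {a w b} → b ≤ w → w < a → ∃[ t ] (0ℚ < t × t ≤ 1ℚ × (1ℚ - t) * a + t * b ≡ w)
interpolate-reversed {a} {w} {b} b≤w w<a =
  let t , 0<t , t≤1 , eq = interpolate { - a} { - w} { - b} (neg-antimono-< w<a) (neg-antimono-≤ b≤w)
  in t , 0<t , t≤1 , (begin
    (1ℚ - t) * a + t * b          ≡⟨ solve 3 (λ t a b → (con 1ℚ :- t) :* a :+ t :* b := :- ((con 1ℚ :- t) :* (:- a) :+ t :* (:- b))) refl t a b ⟩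
    - ((1ℚ - t) * - a + t * - b)  ≡⟨ cong -_ eq ⟩
    - - w                         ≡⟨ solve 1 (λ w → :- (:- w) := w) refl w ⟩
    w                             ∎)
  where open ≡-Reasoning

convex-combination-below : ∀ {t p q} → 0ℚ < t → q < p → (1ℚ - t) * p + t * q < p
convex-combination-below {t} {p} {q} 0<t q<p = subst₂ _<_
  (solve 3 (λ t p q → p :- t :* (p :- q) := (con 1ℚ :- t) :* p :+ t :* q) refl t p q)
  (+-identityʳ p)
  (+-monoʳ-< p (neg-antimono-< (*-pos 0<t (0<q-p q<p))))

vertical-line-meets-segment : ∀ {a b w y₀ y₁} → (a < w × w ≤ b) ⊎ (b ≤ w × w < a) → y₁ < y₀ →
  ∃[ y ] (y < y₀ × OnSegment (w , y) (a , y₀) (b , y₁))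
vertical-line-meets-segment {a} {b} {w} {y₀} {y₁} w-beyond-a y₁<y₀ =
  let t , 0<t , t≤1 , eq = interpolation w-beyond-a
  in (1ℚ - t) * y₀ + t * y₁ , convex-combination-below 0<t y₁<y₀ , (t , <⇒≤ 0<t , t≤1 , sym eq , refl)
  where
  interpolation : (a < w × w ≤ b) ⊎ (b ≤ w × w < a) → ∃[ t ] (0ℚ < t × t ≤ 1ℚ × (1ℚ - t) * a + t * b ≡ w)
  interpolation (inj₁ (a<w , w≤b)) = interpolate a<w w≤b
  interpolation (inj₂ (b≤w , w<a)) = interpolate-reversed b≤w w<a

segments-cross : ∀ {a b e f y₀ y₁} → a < b → f < e →
  ∃[ P ] (OnSegment P (a , y₀) (e , y₁) × OnSegment P (b , y₀) (f , y₁))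
segments-cross {a} {b} {e} {f} {y₀} {y₁} a<b f<e =
  let t , 0<t , t≤1 , eq = ratio-in-unit-interval (0<q-p a<b) b-a≤b-a+e-f
  in ((1ℚ - t) * a + t * e , (1ℚ - t) * y₀ + t * y₁)
     , (t , <⇒≤ 0<t , t≤1 , refl , refl) , (t , <⇒≤ 0<t , t≤1 , same-x t eq , refl)
  where
  open ≡-Reasoning
  b-a≤b-a+e-f : b - a ≤ (b - a) + (e - f)
  b-a≤b-a+e-f = subst (_≤ (b - a) + (e - f)) (+-identityʳ (b - a)) (+-monoʳ-≤ (b - a) (<⇒≤ (0<q-p f<e)))
  same-x : ∀ t → t * ((b - a) + (e - f)) ≡ b - a → (1ℚ - t) * a + t * e ≡ (1ℚ - t) * b + t * f
  same-x t eq = begin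
    (1ℚ - t) * a + t * e
      ≡⟨ solve 5 (λ t a b e f → (con 1ℚ :- t) :* a :+ t :* e
                 := ((con 1ℚ :- t) :* b :+ t :* f) :+ ((a :- b) :+ t :* ((b :- a) :+ (e :- f)))) refl t a b e f ⟩
    ((1ℚ - t) * b + t * f) + ((a - b) + t * ((b - a) + (e - f)))
      ≡⟨ cong (λ z → ((1ℚ - t) * b + t * f) + ((a - b) + z)) eq ⟩
    ((1ℚ - t) * b + t * f) + ((a - b) + (b - a))
      ≡⟨ solve 3 (λ c a b → c :+ ((a :- b) :+ (b :- a)) := c) refl ((1ℚ - t) * b + t * f) a b ⟩
    (1ℚ - t) * b + t * f
      ∎

Between : ℚ → ℚ → ℚ → Set
Between a b c = (a < b × b < c) ⊎ (c < b × b < a)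

one-lies-between : ∀ {a b c} → a ≢ b → a ≢ c → b ≢ c → Between a b c ⊎ Between b a c ⊎ Between a c b
one-lies-between {a} {b} {c} a≢b a≢c b≢c with <-cmp a b | <-cmp b c | <-cmp a c
... | tri≈ _ a≡b _   | _              | _              = ⊥-elim (a≢b a≡b)
... | _              | tri≈ _ b≡c _   | _              = ⊥-elim (b≢c b≡c)
... | _              | _              | tri≈ _ a≡c _   = ⊥-elim (a≢c a≡c)
... | tri< a<b _ _   | tri< b<c _ _   | _              = inj₁ (inj₁ (a<b , b<c))
... | tri> _ _ b<a   | tri> _ _ c<b   | _              = inj₁ (inj₂ (c<b , b<a))
... | tri< a<b _ _   | tri> _ _ c<b   | tri< a<c _ _   = inj₂ (inj₂ (inj₁ (a<c , c<b)))
... | tri< a<b _ _   | tri> _ _ c<b   | tri> _ _ c<a   = inj₂ (inj₁ (inj₂ (c<a , a<b)))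
... | tri> _ _ b<a   | tri< b<c _ _   | tri< a<c _ _   = inj₂ (inj₁ (inj₁ (b<a , a<c)))
... | tri> _ _ b<a   | tri< b<c _ _   | tri> _ _ c<a   = inj₂ (inj₂ (inj₂ (b<c , c<a)))

module BFSDepth {n} (G : Graph n) (d : Fin n → ℕ) where

  parents-same-depth : ∀ {p q v} → Parent G d p v → Parent G d q v → d p ≡ d q
  parents-same-depth (_ , dp) (_ , dq) = ℕ.suc-injective (trans dp (sym dq))

  arc-descends : ∀ {u v} → Arc G d u v → - ℕtoℚ (d v) < - ℕtoℚ (d u)
  arc-descends (_ , du) = neg-antimono-< (ℕtoℚ-mono-< (ℕ.≤-reflexive du))

  tail-or-head-shared : ∀ {p c q v w} → Arc G d p c → Arc G d q v → d p ≡ d q →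
    w ≡ p ⊎ w ≡ c → w ≡ q ⊎ w ≡ v → p ≡ q ⊎ c ≡ v
  tail-or-head-shared _        _        _     (inj₁ refl) (inj₁ refl) = inj₁ refl
  tail-or-head-shared _        _        _     (inj₂ refl) (inj₂ refl) = inj₂ refl
  tail-or-head-shared _        (_ , dv) dp≡dq (inj₁ refl) (inj₂ refl) = ⊥-elim (ℕ.1+n≢n (trans dv dp≡dq))
  tail-or-head-shared (_ , dc) _        dp≡dq (inj₂ refl) (inj₁ refl) = ⊥-elim (ℕ.1+n≢n (trans dc (sym dp≡dq)))

module _ {n} {G : Graph n} {d : Fin n → ℕ} {x : Fin n → ℚ} (drawing : GoodDrawing G d x) where
  open GoodDrawing drawing
  open BFSDepth G d

  -- Otherwise the downward ray from w would meet the arc uv.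
  no-vertex-above-arc : ∀ {u v w} → Arc G d u v → d w ≡ d u →
    ¬ ((x u < x w × x w ≤ x v) ⊎ (x v ≤ x w × x w < x u))
  no-vertex-above-arc {u} {v} {w} uv dw≡du w-over-uv =
    let y , y<yu , y∈uv = vertical-line-meets-segment w-over-uv (arc-descends uv)
    in rayFree w y (subst (λ k → y < - ℕtoℚ k) (sym dw≡du) y<yu) (inj₂ (u , v , uv , y∈uv))

  arcs-do-not-cross : ∀ {p c q v} → Arc G d p c → Arc G d q v → d p ≡ d q → x p < x q → ¬ (x v < x c)
  arcs-do-not-cross {p} {c} {q} {v} pc@(_ , dc) qv@(_ , dv) dp≡dq xp<xq xv<xc =
    let P , P∈pc , P∈qv = segments-cross {y₀ = - ℕtoℚ (d p)} {y₁ = - ℕtoℚ (d c)} xp<xq xv<xc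
        w , w∈pc , w∈qv , _ = edgesDisjoint p c q v pc qv (p≢q ∘ proj₁) P P∈pc
          (subst₂ (λ i j → OnSegment P (x q , - ℕtoℚ i) (x v , - ℕtoℚ j)) dp≡dq dc≡dv P∈qv)
    in [ p≢q , c≢v ]′ (tail-or-head-shared pc qv dp≡dq w∈pc w∈qv)
    where
    p≢q : p ≢ q
    p≢q p≡q = <-irrefl (cong x p≡q) xp<xq
    c≢v : c ≢ v
    c≢v c≡v = <-irrefl (cong x (sym c≡v)) xv<xc
    dc≡dv : d c ≡ d v
    dc≡dv = trans (sym dc) (trans (cong suc dp≡dq) dv)

  parents-consecutive : ∀ {p q v} → Parent G d p v → Parent G d q v → x p < x q → Consecutive d x p q
  parents-consecutive {p} {q} {v} pv qv xp<xq = dp≡dq , nothing-between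
    where
    dp≡dq : d p ≡ d q
    dp≡dq = parents-same-depth pv qv
    nothing-between : ∀ w → d w ≡ d p → ¬ (x p < x w × x w < x q)
    nothing-between w dw≡dp (xp<xw , xw<xq) with x w ≤? x v
    ... | yes xw≤xv = no-vertex-above-arc pv dw≡dp (inj₁ (xp<xw , xw≤xv))
    ... | no xw≰xv  = no-vertex-above-arc qv (trans dw≡dp dp≡dq) (inj₂ (<⇒≤ (≰⇒> xw≰xv) , xw<xq))

  left-parent-rightmost : ∀ {p q v} → Parent G d p v → Parent G d q v → x p < x q → RightmostChild G d x v p
  left-parent-rightmost pv qv xp<xq =
    pv , λ c pc → ≮⇒≥ (arcs-do-not-cross pc qv (parents-same-depth pv qv) xp<xq)

  right-parent-leftmost : ∀ {p q v} → Parent G d p v → Parent G d q v → x p < x q → LeftmostChild G d x v q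
  right-parent-leftmost pv qv xp<xq =
    qv , λ c qc → ≮⇒≥ (arcs-do-not-cross pv qc (parents-same-depth pv qv) xp<xq)

  parents-injective-x : ∀ {p q v} → Parent G d p v → Parent G d q v → x p ≡ x q → p ≡ q
  parents-injective-x pv qv xp≡xq = injective _ _ (cong₂ _,_ xp≡xq (cong (-_ ∘ ℕtoℚ) (parents-same-depth pv qv)))

  no-parent-between-parents : ∀ {a b c v} → Parent G d a v → Parent G d b v → Parent G d c v →
    ¬ Between (x a) (x b) (x c)
  no-parent-between-parents {b = b} av bv cv (inj₁ (xa<xb , xb<xc)) =
    proj₂ (parents-consecutive av cv (<-trans xa<xb xb<xc)) b (parents-same-depth bv av) (xa<xb , xb<xc)
  no-parent-between-parents {b = b} av bv cv (inj₂ (xc<xb , xb<xa)) =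
    proj₂ (parents-consecutive cv av (<-trans xc<xb xb<xa)) b (parents-same-depth bv cv) (xc<xb , xb<xa)

  at-most-two-parents : ∀ {p₁ p₂ p₃ v} → Parent G d p₁ v → Parent G d p₂ v → Parent G d p₃ v →
    p₁ ≡ p₂ ⊎ p₁ ≡ p₃ ⊎ p₂ ≡ p₃
  at-most-two-parents {p₁} {p₂} {p₃} v₁ v₂ v₃ with p₁ Fin.≟ p₂ | p₁ Fin.≟ p₃ | p₂ Fin.≟ p₃
  ... | yes p₁≡p₂ | _         | _         = inj₁ p₁≡p₂
  ... | _         | yes p₁≡p₃ | _         = inj₂ (inj₁ p₁≡p₃)
  ... | _         | _         | yes p₂≡p₃ = inj₂ (inj₂ p₂≡p₃)
  ... | no p₁≢p₂  | no p₁≢p₃  | no p₂≢p₃  =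
    ⊥-elim ([ no-parent-between-parents v₁ v₂ v₃
           , [ no-parent-between-parents v₂ v₁ v₃ , no-parent-between-parents v₁ v₃ v₂ ]′ ]′
           (one-lies-between (p₁≢p₂ ∘ parents-injective-x v₁ v₂) (p₁≢p₃ ∘ parents-injective-x v₁ v₃)
                             (p₂≢p₃ ∘ parents-injective-x v₂ v₃)))

corollary1 : ∀ {n} (G : Graph n) (r : Fin n) (d : Fin n → ℕ) (x : Fin n → ℚ) →
    Connected G → Outerplanar G → IsDistFrom G r d → GoodDrawing G d x →
    (∀ v p₁ p₂ p₃ → Parent G d p₁ v → Parent G d p₂ v → Parent G d p₃ v →
       p₁ ≡ p₂ ⊎ p₁ ≡ p₃ ⊎ p₂ ≡ p₃)
    × (∀ v p q → Parent G d p v → Parent G d q v → x p < x q →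
         Consecutive d x p q × RightmostChild G d x v p × LeftmostChild G d x v q)
corollary1 G r d x _ _ _ drawing =
    (λ v p₁ p₂ p₃ → at-most-two-parents drawing)
  , (λ v p q pv qv xp<xq → parents-consecutive drawing pv qv xp<xq
                         , left-parent-rightmost drawing pv qv xp<xq
                         , right-parent-leftmost drawing pv qv xp<xq)
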